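{- Let $m,n,q$ be positive integers, $C=(c_1,\dots,c_n)\in\mathrm{Mat}_{m\times n}(\mathbb{Z})$ and $b=(b_1,\dots,b_n)\in\mathbb{Z}^n$. For $J\subseteq[n]$ let $H_{J,q}=\{z\in\mathbb{Z}_q^m: z[c_i]_q=[b_i]_q\ \text{for all } i\in J\}$ and $H_{j,q}=H_{\{j\},q}$; for $J=\{j_1<\cdots<j_k\}$ let $C_J=(c_{j_1},\dots,c_{j_k})$ and $b_J=(b_{j_1},\dots,b_{j_k})$. Then for any $j\in[n]$ and any $J\subseteq[n]$ such that $H_{J,q}\neq\emptyset$, we have $H_{j,q}\supseteq H_{J,q}$ if and only if both of the following hold: (a) the vector $([b_j]_q,[b_J]_q)\in\mathbb{Z}_q^{|J|+1}$ lies in the $\mathbb{Z}_q$-submodule of $\mathbb{Z}_q^{|J|+1}$ generated by the rows of the matrix $([c_j]_q,[C_J]_q)\in\mathrm{Mat}_{m\times(|J|+1)}(\mathbb{Z}_q)$; (b) $[c_j]_q\in\mathbb{Z}_q^m$ lies in the $\mathbb{Z}_q$-submodule of $\mathbb{Z}_q^m$ generated by the columns of $[C_J]_q\in\mathrm{Mat}_{m\times|J|}(\mathbb{Z}_q)$.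
   Context: $[n]=\{1,\dots,n\}$, $\mathbb{Z}_q=\mathbb{Z}/q\mathbb{Z}$, $[\cdot]_q$ is entrywise reduction modulo $q$; $H_{\emptyset,q}=\mathbb{Z}_q^m$, and for $J=\emptyset$ the submodule generated by no columns is $\{0\}$. -}

module Defs where

open import Data.Nat using (ℕ; zero; suc)
open import Data.Integer using (ℤ; +_; _+_; _-_; _*_)
open import Data.Integer.Divisibility using (_∣_)
open import Data.Fin using (Fin; zero; suc)
open import Data.Fin.Subset using (Subset; _∈_)
open import Data.Vec using (lookup)
open import Data.Bool using (if_then_else_)
open import Data.Product using (Σ; _×_)
open import Function using (_∘_)

-- Elements of ℤ_q are represented by integers; equality in ℤ_q is congruence mod q.
-- [x]_q = [y]_q  iff  q ∣ x - y
_≡_[mod_] : ℤ → ℤ → ℕ → Set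
x ≡ y [mod q ] = (+ q) ∣ (x - y)

sumFin : ∀ {m} → (Fin m → ℤ) → ℤ
sumFin {zero}  f = + 0
sumFin {suc m} f = f zero + sumFin (f ∘ suc)

-- an m×n integer matrix C, columns c_i = λ k → C k i
Mat : ℕ → ℕ → Set
Mat m n = Fin m → Fin n → ℤ

dotCol : ∀ {m n} → (Fin m → ℤ) → Mat m n → Fin n → ℤ
dotCol z C i = sumFin (λ k → z k * C k i)

InH : ∀ {m n} (q : ℕ) (C : Mat m n) (b : Fin n → ℤ) (J : Subset n) (z : Fin m → ℤ) → Set
InH q C b J z = ∀ i → i ∈ J → dotCol z C i ≡ b i [mod q ]

HSubset : ∀ {m n} (q : ℕ) (C : Mat m n) (b : Fin n → ℤ) (J : Subset n) (j : Fin n) → Set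
HSubset q C b J j = ∀ z → InH q C b J z → InH q C b (Data.Fin.Subset.⁅ j ⁆) z

HNonempty : ∀ {m n} (q : ℕ) (C : Mat m n) (b : Fin n → ℤ) (J : Subset n) → Set
HNonempty {m} q C b J = Σ (Fin m → ℤ) (λ z → InH q C b J z)

-- (a): ([b_j]_q, [b_J]_q) lies in the ℤ_q-row space of ([c_j]_q, [C_J]_q):
-- some coefficients λ_1..λ_m with Σ_k λ_k (row k) equal to the target entrywise mod q.
-- (ℤ_q-coefficients are represented by integer representatives.)
CondA : ∀ {m n} (q : ℕ) (C : Mat m n) (b : Fin n → ℤ) (J : Subset n) (j : Fin n) → Set
CondA {m} q C b J j =
  Σ (Fin m → ℤ) (λ lam →
    (dotCol lam C j ≡ b j [mod q ]) × (∀ i → i ∈ J → dotCol lam C i ≡ b i [mod q ]))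

-- (b): [c_j]_q lies in the ℤ_q-column space of [C_J]_q:
-- some coefficients μ_i (i ∈ J) with Σ_{i∈J} μ_i c_i ≡ c_j mod q entrywise
-- (empty J: the zero submodule).
CondB : ∀ {m n} (q : ℕ) (C : Mat m n) (J : Subset n) (j : Fin n) → Set
CondB {m} {n} q C J j =
  Σ (Fin n → ℤ) (λ mu →
    ∀ k → sumFin (λ i → if lookup J i then mu i * C k i else + 0) ≡ C k j [mod q ])

-- Sufficiency: by (b), z ∙ c_j ≈ Σ_{i∈J} μ_i (z ∙ c_i)
-- ≈ Σ_{i∈J} μ_i b_i for every z ∈ H_J, a value independent of z, and the witness of (a) shows it
-- is b_j. Necessity: (a) is witnessed by any z₀ ∈ H_J. For (b), a z killing every c_i (i ∈ J)
-- gives z₀ + z ∈ H_J, hence z ∙ c_j ≈ 0; so c_j is orthogonal to the left kernel of C_J, and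
-- over ℤ/q this puts it in the column span of C_J (the Fredholm alternative, which holds since
-- ℤ/q is self-injective). The alternative is proved by induction on the number of rows: column
-- operations turn the first row into (g, 0, …, 0), and g x ≈ d₀ is solvable exactly when
-- (q / gcd(g, q)) d₀ ≈ 0, which compatibility guarantees.

module Submission where

open import Defs
open import Data.Nat using (ℕ; _≤_)
open import Data.Integer using (ℤ)
open import Data.Fin using (Fin)
open import Data.Fin.Subset using (Subset)
open import Data.Product using (_×_)
open import Function.Bundles using (_⇔_)

import Data.Nat as ℕ
open import Data.Nat.GCD using (gcd-GCD; module Bézout)
open import Data.Integer using (+_; -[1+_]; _+_; _-_; _*_; -_; 0ℤ; 1ℤ; -1ℤ; ∣_∣; NonZero; ≢-nonZero)
open import Data.Integer.Properties
  using (+-comm; +-identityˡ; +-identityʳ; +-inverseˡ; +-inverseʳ; neg-distribʳ-*; *-identityˡ; *-zeroʳ; *-comm; -1*i≡-i;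
         pos-+; pos-*; +-injective; *-cancelˡ-≡)
open import Data.Integer.GCD using (gcd; gcd[i,j]∣i; gcd[i,j]∣j)
open import Data.Integer.Divisibility.Signed as Signed
  using (divides; ∣ᵤ⇒∣; ∣⇒∣ᵤ; ∣-trans; ∣m∣n⇒∣m+n; ∣m⇒∣-m; ∣n⇒∣m*n; ∣m⇒∣m*n)
open import Data.Integer.Tactic.RingSolver using (solve-∀)
open import Data.Fin using (zero; suc)
open import Data.Fin.Subset using (_∈_)
open import Data.Fin.Subset.Properties using (x∈⁅x⁆; x∈⁅y⁆⇒x≡y)
open import Data.Vec using (lookup; _∷_)
open import Data.Vec.Properties using (lookup⇒[]=; []=⇒lookup)
open import Data.Bool using (true; false; if_then_else_)
open import Data.Product using (∃; ∃₂; _,_; proj₁; proj₂)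
open import Function using (_∘_)
open import Function.Bundles using (mk⇔)
open import Level using (0ℓ)
open import Relation.Binary.Bundles using (Setoid)
open import Relation.Binary.PropositionalEquality

infix 8 _∙_
_∙_ : ∀ {n} → (Fin n → ℤ) → (Fin n → ℤ) → ℤ
x ∙ y = sumFin (λ i → x i * y i)

col : ∀ {m n} → Mat m n → Fin n → Fin m → ℤ
col A i l = A l i

∙-comm : ∀ {n} (x y : Fin n → ℤ) → x ∙ y ≡ y ∙ x
∙-comm {ℕ.zero}  x y = refl
∙-comm {ℕ.suc n} x y = cong₂ _+_ (*-comm (x zero) (y zero)) (∙-comm (x ∘ suc) (y ∘ suc))

∙-zeroˡ : ∀ {n} (y : Fin n → ℤ) → (λ _ → 0ℤ) ∙ y ≡ 0ℤ
∙-zeroˡ {ℕ.zero}  y = refl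
∙-zeroˡ {ℕ.suc n} y = trans (+-identityˡ _) (∙-zeroˡ (y ∘ suc))

∙-distribʳ-+ : ∀ {n} (x y z : Fin n → ℤ) → (λ i → x i + y i) ∙ z ≡ x ∙ z + y ∙ z
∙-distribʳ-+ {ℕ.zero}  x y z = refl
∙-distribʳ-+ {ℕ.suc n} x y z =
  trans (cong (λ s → (x zero + y zero) * z zero + s) (∙-distribʳ-+ (x ∘ suc) (y ∘ suc) (z ∘ suc)))
        (shuffle (x zero) (y zero) (z zero) _ _)
  where
  shuffle : ∀ a b c s t → (a + b) * c + (s + t) ≡ (a * c + s) + (b * c + t)
  shuffle = solve-∀

∙-homogeneousˡ : ∀ {n} (c : ℤ) (x y : Fin n → ℤ) → (λ i → c * x i) ∙ y ≡ c * (x ∙ y)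
∙-homogeneousˡ {ℕ.zero}  c x y = sym (*-zeroʳ c)
∙-homogeneousˡ {ℕ.suc n} c x y =
  trans (cong (λ s → c * x zero * y zero + s) (∙-homogeneousˡ c (x ∘ suc) (y ∘ suc)))
        (factor c (x zero) (y zero) _)
  where
  factor : ∀ c a b s → c * a * b + c * s ≡ c * (a * b + s)
  factor = solve-∀

∙-congʳ : ∀ {n} (x : Fin n → ℤ) {y y′ : Fin n → ℤ} → (∀ i → y i ≡ y′ i) → x ∙ y ≡ x ∙ y′
∙-congʳ {ℕ.zero}  x eq = refl
∙-congʳ {ℕ.suc n} x eq = cong₂ _+_ (cong (x zero *_) (eq zero)) (∙-congʳ (x ∘ suc) (eq ∘ suc))

∙-linearˡ : ∀ {n} (c : ℤ) (x y z : Fin n → ℤ) → (λ i → x i + c * y i) ∙ z ≡ x ∙ z + c * (y ∙ z)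
∙-linearˡ c x y z =
  trans (∙-distribʳ-+ x (λ i → c * y i) z) (cong (λ s → x ∙ z + s) (∙-homogeneousˡ c y z))

∙-linearʳ : ∀ {n} (c : ℤ) (x y z : Fin n → ℤ) → x ∙ (λ i → y i + c * z i) ≡ x ∙ y + c * (x ∙ z)
∙-linearʳ c x y z = begin
  x ∙ (λ i → y i + c * z i) ≡⟨ ∙-comm x _ ⟩
  (λ i → y i + c * z i) ∙ x ≡⟨ ∙-linearˡ c y z x ⟩
  y ∙ x + c * (z ∙ x)       ≡⟨ cong₂ (λ s t → s + c * t) (∙-comm y x) (∙-comm z x) ⟩
  x ∙ y + c * (x ∙ z)       ∎
  where open ≡-Reasoning

∙-homogeneousʳ : ∀ {n} (c : ℤ) (x y : Fin n → ℤ) → x ∙ (λ i → c * y i) ≡ c * (x ∙ y)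
∙-homogeneousʳ c x y =
  trans (∙-comm x _) (trans (∙-homogeneousˡ c y x) (cong (c *_) (∙-comm y x)))

∙-assoc : ∀ {m n} (x : Fin m → ℤ) (M : Mat m n) (y : Fin n → ℤ) →
          x ∙ (λ l → M l ∙ y) ≡ (λ i → x ∙ col M i) ∙ y
∙-assoc {ℕ.zero}  x M y = sym (∙-zeroˡ y)
∙-assoc {ℕ.suc m} x M y = begin
  x zero * (M zero ∙ y) + (x ∘ suc) ∙ (λ l → M (suc l) ∙ y)
    ≡⟨ cong (λ s → x zero * (M zero ∙ y) + s) (∙-assoc (x ∘ suc) (M ∘ suc) y) ⟩
  x zero * (M zero ∙ y) + rest ∙ y
    ≡⟨ cong (λ s → s + rest ∙ y) (sym (∙-homogeneousˡ (x zero) (M zero) y)) ⟩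
  (λ i → x zero * M zero i) ∙ y + rest ∙ y
    ≡⟨ sym (∙-distribʳ-+ (λ i → x zero * M zero i) rest y) ⟩
  (λ i → x ∙ col M i) ∙ y
    ∎
  where
  open ≡-Reasoning
  rest : _ → ℤ
  rest i = (x ∘ suc) ∙ col (M ∘ suc) i

+∣i∣-multiple : ∀ i → ∃ λ s → + ∣ i ∣ ≡ s * i
+∣i∣-multiple (+ n)    = 1ℤ  , sym (*-identityˡ (+ n))
+∣i∣-multiple -[1+ n ] = -1ℤ , sym (-1*i≡-i -[1+ n ])

ℤ-identity : ∀ {d m n} → Bézout.Identity d m n → ∃₂ λ u v → + d ≡ u * + m + v * + n
ℤ-identity {d} {m} {n} (Bézout.+- x y eq) = + x , - + y , (begin
  + d                                ≡⟨ cancel (+ d) (+ y) (+ n) ⟩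
  (+ d + + y * + n) + - + y * + n    ≡⟨ cong (λ u → u + - + y * + n) lifted ⟩
  + x * + m + - + y * + n            ∎)
  where
  open ≡-Reasoning
  cancel : ∀ a b c → a ≡ (a + b * c) + - b * c
  cancel = solve-∀
  lifted : + d + + y * + n ≡ + x * + m
  lifted = begin
    + d + + y * + n     ≡⟨ cong (λ u → + d + u) (sym (pos-* y n)) ⟩
    + d + + (y ℕ.* n)   ≡⟨ sym (pos-+ d (y ℕ.* n)) ⟩
    + (d ℕ.+ y ℕ.* n)   ≡⟨ cong +_ eq ⟩
    + (x ℕ.* m)         ≡⟨ pos-* x m ⟩
    + x * + m           ∎
ℤ-identity {m = m} {n} (Bézout.-+ x y eq) with ℤ-identity (Bézout.+- y x eq)
... | u , v , d≡ = v , u , trans d≡ (+-comm (u * + n) (v * + m))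

-- Opaque, as is `annihilator` below: only the specifications are used, and
-- letting the type checker unfold the gcd computation is prohibitively expensive.
opaque
  bézout : ∀ i j → ∃₂ λ u v → gcd i j ≡ u * i + v * j
  bézout i j with ℤ-identity (Bézout.identity (gcd-GCD ∣ i ∣ ∣ j ∣)) | +∣i∣-multiple i | +∣i∣-multiple j
  ... | u , v , gcd≡ | s , ∣i∣≡s*i | t , ∣j∣≡t*j = u * s , v * t , (begin
    gcd i j                          ≡⟨ gcd≡ ⟩
    u * + ∣ i ∣ + v * + ∣ j ∣        ≡⟨ cong₂ (λ a b → u * a + v * b) ∣i∣≡s*i ∣j∣≡t*j ⟩
    u * (s * i) + v * (t * j)        ≡⟨ regroup u s i v t j ⟩
    u * s * i + v * t * j            ∎)
    where
    open ≡-Reasoning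
    regroup : ∀ a b c d e f → a * (b * c) + d * (e * f) ≡ a * b * c + d * e * f
    regroup = solve-∀

row-gcd : ∀ {k} (r : Fin k → ℤ) → ∃ λ p → ∀ i → (r ∙ p) Signed.∣ r i
row-gcd {ℕ.zero}  r = (λ ()) , λ ()
row-gcd {ℕ.suc k} r with row-gcd (r ∘ suc)
... | p′ , g′∣tail with bézout (r zero) ((r ∘ suc) ∙ p′)
... | u , v , gcd≡ = p , divides-row
  where
  g′ = (r ∘ suc) ∙ p′
  p : Fin (ℕ.suc k) → ℤ
  p zero    = u
  p (suc i) = v * p′ i
  r∙p≡gcd : r ∙ p ≡ gcd (r zero) g′
  r∙p≡gcd = begin
    r zero * u + (r ∘ suc) ∙ (λ i → v * p′ i) ≡⟨ cong (λ s → r zero * u + s) (∙-homogeneousʳ v (r ∘ suc) p′) ⟩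
    r zero * u + v * g′                       ≡⟨ cong (λ s → s + v * g′) (*-comm (r zero) u) ⟩
    u * r zero + v * g′                       ≡⟨ sym gcd≡ ⟩
    gcd (r zero) g′                           ∎
    where open ≡-Reasoning
  divides-row : ∀ i → (r ∙ p) Signed.∣ r i
  divides-row zero    = subst (Signed._∣ r zero) (sym r∙p≡gcd) (∣ᵤ⇒∣ (gcd[i,j]∣i (r zero) g′))
  divides-row (suc i) =
    subst (Signed._∣ r (suc i)) (sym r∙p≡gcd) (∣-trans (∣ᵤ⇒∣ (gcd[i,j]∣j (r zero) g′)) (g′∣tail i))

-- Zeroing the columns outside J, rather than deleting them, keeps the column
-- span equal to that of C_J.
_↾_ : ∀ {m n} → Mat m n → Subset n → Mat m n
(C ↾ J) l i = if lookup J i then C l i else 0ℤ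

↾-col∙ : ∀ {m n} (C : Mat m n) J (z : Fin m → ℤ) i →
         z ∙ col (C ↾ J) i ≡ (if lookup J i then z ∙ col C i else 0ℤ)
↾-col∙ C J z i with lookup J i
... | true  = refl
... | false = trans (∙-comm z _) (∙-zeroˡ z)

↾-row∙ : ∀ {m n} (C : Mat m n) J l (μ : Fin n → ℤ) →
         (C ↾ J) l ∙ μ ≡ sumFin (λ i → if lookup J i then μ i * C l i else 0ℤ)
↾-row∙ {n = ℕ.zero}  C J l μ = refl
↾-row∙ {n = ℕ.suc n} C (β ∷ J) l μ = cong₂ _+_ (if-* β) (↾-row∙ (λ l′ → C l′ ∘ suc) J l (μ ∘ suc))
  where
  if-* : ∀ β → (if β then C l zero else 0ℤ) * μ zero ≡ (if β then μ zero * C l zero else 0ℤ)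
  if-* true  = *-comm (C l zero) (μ zero)
  if-* false = refl

module Modulo (q : ℕ) .{{_ : ℕ.NonZero q}} where

  -- A record rather than a synonym for _≡_[mod_], so that x and y can be inferred.
  infix 4 _≈_
  record _≈_ (x y : ℤ) : Set where
    constructor ≡[mod]⇒≈
    field ≈⇒≡[mod] : x ≡ y [mod q ]

  open _≈_ public

  private
    via : ∀ {e x y} → e ≡ x - y → (+ q) Signed.∣ e → x ≈ y
    via eq q∣e = ≡[mod]⇒≈ (∣⇒∣ᵤ (subst ((+ q) Signed.∣_) eq q∣e))

    q∣ : ∀ {x y} → x ≈ y → (+ q) Signed.∣ (x - y)
    q∣ = ∣ᵤ⇒∣ ∘ ≈⇒≡[mod]

  [x+t*q]≈x : ∀ x t → x + t * + q ≈ x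
  [x+t*q]≈x x t = via (sym (cancel x (t * + q))) (divides t refl)
    where
    cancel : ∀ a b → (a + b) - a ≡ b
    cancel = solve-∀

  ≈0⇒multiple : ∀ {x} → x ≈ 0ℤ → ∃ λ t → x ≡ t * + q
  ≈0⇒multiple {x} x≈0 with q∣ x≈0
  ... | divides t eq = t , trans (sym (+-identityʳ x)) eq

  ≈-reflexive : ∀ {x y} → x ≡ y → x ≈ y
  ≈-reflexive {x} refl = via (sym (+-inverseʳ x)) (divides 0ℤ refl)

  ≈-refl : ∀ {x} → x ≈ x
  ≈-refl = ≈-reflexive refl

  ≈-sym : ∀ {x y} → x ≈ y → y ≈ x
  ≈-sym {x} {y} x≈y = via (flip x y) (∣m⇒∣-m (q∣ x≈y))
    where
    flip : ∀ a b → - (a - b) ≡ b - a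
    flip = solve-∀

  ≈-trans : ∀ {x y z} → x ≈ y → y ≈ z → x ≈ z
  ≈-trans {x} {y} {z} x≈y y≈z = via (telescope x y z) (∣m∣n⇒∣m+n (q∣ x≈y) (q∣ y≈z))
    where
    telescope : ∀ a b c → (a - b) + (b - c) ≡ a - c
    telescope = solve-∀

  ≈-setoid : Setoid 0ℓ 0ℓ
  ≈-setoid = record { _≈_ = _≈_ ; isEquivalence = record { refl = ≈-refl ; sym = ≈-sym ; trans = ≈-trans } }

  +-cong : ∀ {x x′ y y′} → x ≈ x′ → y ≈ y′ → x + y ≈ x′ + y′
  +-cong {x} {x′} {y} {y′} x≈x′ y≈y′ = via (regroup x x′ y y′) (∣m∣n⇒∣m+n (q∣ x≈x′) (q∣ y≈y′))
    where
    regroup : ∀ a a′ b b′ → (a - a′) + (b - b′) ≡ (a + b) - (a′ + b′)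
    regroup = solve-∀

  *-cong : ∀ {x x′ y y′} → x ≈ x′ → y ≈ y′ → x * y ≈ x′ * y′
  *-cong {x} {x′} {y} {y′} x≈x′ y≈y′ =
    via (regroup x x′ y y′) (∣m∣n⇒∣m+n (∣n⇒∣m*n x (q∣ y≈y′)) (∣m⇒∣m*n y′ (q∣ x≈x′)))
    where
    regroup : ∀ a a′ b b′ → a * (b - b′) + (a - a′) * b′ ≡ a * b - a′ * b′
    regroup = solve-∀

  +-congˡ : ∀ x {y y′} → y ≈ y′ → x + y ≈ x + y′
  +-congˡ x = +-cong (≈-refl {x})

  *-congˡ : ∀ x {y y′} → y ≈ y′ → x * y ≈ x * y′
  *-congˡ x = *-cong (≈-refl {x})

  -‿cong : ∀ {x y} → x ≈ y → - x ≈ - y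
  -‿cong {x} {y} x≈y = via (negate x y) (∣m⇒∣-m (q∣ x≈y))
    where
    negate : ∀ a b → - (a - b) ≡ - a - - b
    negate = solve-∀

  ≈-∙-congˡ : ∀ {n} {x x′ : Fin n → ℤ} (y : Fin n → ℤ) → (∀ i → x i ≈ x′ i) → x ∙ y ≈ x′ ∙ y
  ≈-∙-congˡ {ℕ.zero}  y x≈x′ = ≈-refl
  ≈-∙-congˡ {ℕ.suc n} y x≈x′ = +-cong (*-cong (x≈x′ zero) ≈-refl) (≈-∙-congˡ (y ∘ suc) (x≈x′ ∘ suc))

  ≈-∙-congʳ : ∀ {n} (x : Fin n → ℤ) {y y′ : Fin n → ℤ} → (∀ i → y i ≈ y′ i) → x ∙ y ≈ x ∙ y′
  ≈-∙-congʳ x {y} {y′} y≈y′ =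
    ≈-trans (≈-reflexive (∙-comm x y)) (≈-trans (≈-∙-congˡ x y≈y′) (≈-reflexive (∙-comm y′ x)))

  open import Relation.Binary.Reasoning.Setoid ≈-setoid

  record Annihilator (g : ℤ) : Set where
    field
      ann       : ℤ
      g*ann≈0   : g * ann ≈ 0ℤ
      divisible : ∀ a → ann * a ≈ 0ℤ → ∃ λ x → g * x ≈ a

  -- With ann = q / gcd(g, q): every a killed by ann is a multiple of gcd(g, q),
  -- hence of g modulo q.
  opaque
    annihilator : ∀ g → Annihilator g
    annihilator g with bézout g (+ q) | ∣ᵤ⇒∣ {i = g} (gcd[i,j]∣i g (+ q)) | ∣ᵤ⇒∣ {i = + q} (gcd[i,j]∣j g (+ q))
    ... | u , v , G≡ | divides g/G g≡ | divides y q≡ =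
      record { ann = y ; g*ann≈0 = g*y≈0 ; divisible = divisible }
      where
      G : ℤ
      G = gcd g (+ q)

      instance
        y≢0 : NonZero y
        y≢0 = ≢-nonZero {y} λ y≡0 → ℕ.≢-nonZero⁻¹ q (+-injective (trans q≡ (cong (_* G) y≡0)))

      g*y≈0 : g * y ≈ 0ℤ
      g*y≈0 = begin
        g * y                 ≡⟨ cong (_* y) g≡ ⟩
        g/G * G * y           ≡⟨ regroup g/G G y ⟩
        0ℤ + g/G * (y * G)    ≡⟨ cong (λ t → 0ℤ + g/G * t) (sym q≡) ⟩
        0ℤ + g/G * + q        ≈⟨ [x+t*q]≈x 0ℤ g/G ⟩
        0ℤ                    ∎
        where
        regroup : ∀ a b c → a * b * c ≡ 0ℤ + a * (c * b)
        regroup = solve-∀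

      divisible : ∀ a → y * a ≈ 0ℤ → ∃ λ x → g * x ≈ a
      divisible a y*a≈0 with ≈0⇒multiple y*a≈0
      ... | t , y*a≡t*q = t * u , (begin
        g * (t * u)                   ≈⟨ ≈-sym ([x+t*q]≈x (g * (t * u)) (t * v)) ⟩
        g * (t * u) + t * v * + q     ≡⟨ expand g t u v (+ q) ⟩
        t * (u * g + v * + q)         ≡⟨ cong (t *_) (sym G≡) ⟩
        t * G                         ≡⟨ sym a≡t*G ⟩
        a                             ∎)
        where
        expand : ∀ g t u v q → g * (t * u) + t * v * q ≡ t * (u * g + v * q)
        expand = solve-∀
        swap : ∀ t y G → t * (y * G) ≡ y * (t * G)
        swap = solve-∀
        a≡t*G : a ≡ t * G
        a≡t*G = *-cancelˡ-≡ y a (t * G) (trans y*a≡t*q (trans (cong (t *_) q≡) (swap t y G)))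

  LeftKernel : ∀ {m k} → Mat m k → (Fin m → ℤ) → Set
  LeftKernel A z = ∀ i → z ∙ col A i ≈ 0ℤ

  Compatible : ∀ {m k} → Mat m k → (Fin m → ℤ) → Set
  Compatible A d = ∀ z → LeftKernel A z → z ∙ d ≈ 0ℤ

  Solvable : ∀ {m k} → Mat m k → (Fin m → ℤ) → Set
  Solvable {k = k} A d = ∃ λ (x : Fin k → ℤ) → ∀ l → A l ∙ x ≈ d l

  -- The columns (A p | A − (A p) eᵀ) span the same submodule as the columns of A.
  reduceBy : ∀ {m k} → Mat m k → (p e : Fin k → ℤ) → Mat m (ℕ.suc k)
  reduceBy A p e l zero    = A l ∙ p
  reduceBy A p e l (suc i) = A l i + (- (A l ∙ p)) * e i

  compatible-reduceBy : ∀ {m k} (A : Mat m k) p e {d} → Compatible A d → Compatible (reduceBy A p e) d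
  compatible-reduceBy A p e compat z z∈ker = compat z z∈kerA
    where
    B = reduceBy A p e
    restore : ∀ i l → A l i ≡ B l (suc i) + e i * B l zero
    restore i l = restore′ (A l i) (A l ∙ p) (e i)
      where
      restore′ : ∀ a w c → a ≡ (a + (- w) * c) + c * w
      restore′ = solve-∀
    z∈kerA : LeftKernel A z
    z∈kerA i = begin
      z ∙ col A i                                   ≡⟨ ∙-congʳ z (restore i) ⟩
      z ∙ (λ l → B l (suc i) + e i * B l zero)      ≡⟨ ∙-linearʳ (e i) z (col B (suc i)) (col B zero) ⟩
      z ∙ col B (suc i) + e i * (z ∙ col B zero)    ≈⟨ +-cong (z∈ker (suc i)) (*-congˡ (e i) (z∈ker zero)) ⟩
      0ℤ + e i * 0ℤ                                 ≡⟨ trans (+-identityˡ _) (*-zeroʳ (e i)) ⟩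
      0ℤ                                            ∎

  solvable-reduceBy : ∀ {m k} (A : Mat m k) p e {d} → Solvable (reduceBy A p e) d → Solvable A d
  solvable-reduceBy A p e {d} (x′ , solves) = x , solves′
    where
    x″ = x′ ∘ suc
    c = x′ zero - e ∙ x″
    x : _ → ℤ
    x i = x″ i + c * p i
    regroup : ∀ s t u w → s + (t - u) * w ≡ w * t + (s + (- w) * u)
    regroup = solve-∀
    solves′ : ∀ l → A l ∙ x ≈ d l
    solves′ l = begin
      A l ∙ x                                     ≡⟨ ∙-linearʳ c (A l) x″ p ⟩
      A l ∙ x″ + c * w                            ≡⟨ regroup (A l ∙ x″) (x′ zero) (e ∙ x″) w ⟩
      w * x′ zero + (A l ∙ x″ + (- w) * e ∙ x″)   ≡⟨ cong (λ s → w * x′ zero + s) (sym (∙-linearˡ (- w) (A l) e x″)) ⟩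
      reduceBy A p e l ∙ x′                       ≈⟨ solves l ⟩
      d l                                         ∎
      where
      w = A l ∙ p

  module Pivot {m k} (A : Mat (ℕ.suc m) (ℕ.suc k)) (d : Fin (ℕ.suc m) → ℤ)
               (row₀ : ∀ i → A zero (suc i) ≡ 0ℤ) (compat : Compatible A d) where

    g : ℤ
    g = A zero zero
    open Annihilator (annihilator g) renaming (ann to y)

    -- (y, 0, …, 0) lies in the left kernel of A, so y d₀ ≈ 0.
    first-equation : ∃ λ x₀ → g * x₀ ≈ d zero
    first-equation = divisible (d zero) (≈-trans (≈-reflexive (sym (z₀∙ d))) (compat z₀ z₀∈ker))
      where
      z₀ : Fin (ℕ.suc m) → ℤ
      z₀ zero    = y
      z₀ (suc _) = 0ℤ
      z₀∙ : ∀ v → z₀ ∙ v ≡ y * v zero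
      z₀∙ v = trans (cong (λ s → y * v zero + s) (∙-zeroˡ (v ∘ suc))) (+-identityʳ _)
      z₀∈ker : LeftKernel A z₀
      z₀∈ker zero    = ≈-trans (≈-reflexive (trans (z₀∙ (col A zero)) (*-comm y g))) g*ann≈0
      z₀∈ker (suc i) = ≈-reflexive (trans (z₀∙ (col A (suc i))) (trans (cong (y *_) (row₀ i)) (*-zeroʳ y)))

    x₀ : ℤ
    x₀ = proj₁ first-equation

    -- As g y ≈ 0, x = (x₀ + y t, x′₁, …) solves the first equation for every t; the other
    -- equations then read A′ (t, x′₁, …) ≈ d′.
    A′ : Mat m (ℕ.suc k)
    A′ l zero    = y * A (suc l) zero
    A′ l (suc i) = A (suc l) (suc i)

    d′ : Fin m → ℤ
    d′ l = d (suc l) + (- x₀) * A (suc l) zero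

    -- z′ extends to (z₁, z′) in the left kernel of A by solving g z₁ ≈ − z′ ∙ (A ∘ suc) zero.
    compatible′ : Compatible A′ d′
    compatible′ z′ z′∈ker = begin
      z′ ∙ d′                         ≡⟨ ∙-linearʳ (- x₀) z′ (d ∘ suc) (col (A ∘ suc) zero) ⟩
      z′ ∙ (d ∘ suc) + (- x₀) * a     ≡⟨ cong (λ s → z′ ∙ (d ∘ suc) + s) (neg-swap x₀ a) ⟩
      z′ ∙ (d ∘ suc) + x₀ * - a       ≈⟨ +-congˡ (z′ ∙ (d ∘ suc)) (*-congˡ x₀ (≈-sym g*z₁≈-a)) ⟩
      z′ ∙ (d ∘ suc) + x₀ * (g * z₁)  ≡⟨ cong (λ s → z′ ∙ (d ∘ suc) + s) (rotate x₀ g z₁) ⟩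
      z′ ∙ (d ∘ suc) + z₁ * (g * x₀)  ≈⟨ +-congˡ (z′ ∙ (d ∘ suc)) (*-congˡ z₁ (proj₂ first-equation)) ⟩
      z′ ∙ (d ∘ suc) + z₁ * d zero    ≡⟨ +-comm (z′ ∙ (d ∘ suc)) (z₁ * d zero) ⟩
      z ∙ d                           ≈⟨ compat z z∈ker ⟩
      0ℤ                              ∎
      where
      a = z′ ∙ col (A ∘ suc) zero
      y*-a≈0 : y * - a ≈ 0ℤ
      y*-a≈0 = ≈-trans (≈-reflexive (sym (neg-distribʳ-* y a)))
                 (-‿cong (≈-trans (≈-reflexive (sym (∙-homogeneousʳ y z′ (col (A ∘ suc) zero)))) (z′∈ker zero)))
      z₁ = proj₁ (divisible (- a) y*-a≈0)
      g*z₁≈-a = proj₂ (divisible (- a) y*-a≈0)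
      neg-swap : ∀ x a → (- x) * a ≡ x * - a
      neg-swap = solve-∀
      rotate : ∀ x g z → x * (g * z) ≡ z * (g * x)
      rotate = solve-∀
      z : Fin (ℕ.suc m) → ℤ
      z zero    = z₁
      z (suc l) = z′ l
      z∈ker : LeftKernel A z
      z∈ker zero    = begin
        z₁ * g + a   ≡⟨ cong (_+ a) (*-comm z₁ g) ⟩
        g * z₁ + a   ≈⟨ +-cong g*z₁≈-a ≈-refl ⟩
        - a + a      ≡⟨ +-inverseˡ a ⟩
        0ℤ           ∎
      z∈ker (suc i) = begin
        z₁ * A zero (suc i) + z′ ∙ col A′ (suc i)  ≡⟨ cong (λ s → z₁ * s + z′ ∙ col A′ (suc i)) (row₀ i) ⟩
        z₁ * 0ℤ + z′ ∙ col A′ (suc i)              ≈⟨ +-congˡ (z₁ * 0ℤ) (z′∈ker (suc i)) ⟩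
        z₁ * 0ℤ + 0ℤ                               ≡⟨ trans (+-identityʳ _) (*-zeroʳ z₁) ⟩
        0ℤ                                         ∎

    solvable : Solvable A′ d′ → Solvable A d
    solvable (x′ , solves′) = x , solves
      where
      x : Fin (ℕ.suc k) → ℤ
      x zero    = x₀ + y * x′ zero
      x (suc i) = x′ (suc i)
      solves : ∀ l → A l ∙ x ≈ d l
      solves zero = begin
        g * x zero + (A zero ∘ suc) ∙ (x′ ∘ suc)
          ≈⟨ +-congˡ (g * x zero) (≈-∙-congˡ (x′ ∘ suc) (≈-reflexive ∘ row₀)) ⟩
        g * x zero + (λ _ → 0ℤ) ∙ (x′ ∘ suc)
          ≡⟨ cong (λ s → g * x zero + s) (∙-zeroˡ (x′ ∘ suc)) ⟩
        g * (x₀ + y * x′ zero) + 0ℤ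
          ≡⟨ expand g x₀ y (x′ zero) ⟩
        g * x₀ + g * y * x′ zero
          ≈⟨ +-cong (proj₂ first-equation) (*-cong g*ann≈0 (≈-refl {x′ zero})) ⟩
        d zero + 0ℤ * x′ zero
          ≡⟨ +-identityʳ (d zero) ⟩
        d zero
          ∎
        where
        expand : ∀ g x y t → g * (x + y * t) + 0ℤ ≡ g * x + g * y * t
        expand = solve-∀
      solves (suc l) = begin
        a₀ * (x₀ + y * x′ zero) + S              ≡⟨ regroup a₀ x₀ y (x′ zero) S ⟩
        A′ l ∙ x′ + x₀ * a₀                      ≈⟨ +-cong (solves′ l) ≈-refl ⟩
        d (suc l) + (- x₀) * a₀ + x₀ * a₀        ≡⟨ cancel (d (suc l)) x₀ a₀ ⟩
        d (suc l)                                ∎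
        where
        a₀ = A (suc l) zero
        S = (A (suc l) ∘ suc) ∙ (x′ ∘ suc)
        regroup : ∀ a x y t s → a * (x + y * t) + s ≡ (y * a * t + s) + x * a
        regroup = solve-∀
        cancel : ∀ b x a → b + (- x) * a + x * a ≡ b
        cancel = solve-∀

  compatible⇒solvable : ∀ {m k} (A : Mat m k) d → Compatible A d → Solvable A d
  compatible⇒solvable {ℕ.zero}  A d _      = (λ _ → 0ℤ) , λ ()
  compatible⇒solvable {ℕ.suc m} {k} A d compat with row-gcd (A zero)
  ... | p , content∣row = solvable-reduceBy A p e (P.solvable (compatible⇒solvable P.A′ P.d′ P.compatible′))
    where
    e : Fin k → ℤ
    e i = Signed._∣_.quotient (content∣row i)
    B : Mat (ℕ.suc m) (ℕ.suc k)
    B = reduceBy A p e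
    row₀ : ∀ i → B zero (suc i) ≡ 0ℤ
    row₀ i = trans (cong (λ a → a + (- (A zero ∙ p)) * e i) (Signed._∣_.equality (content∣row i)))
                   (cancel (e i) (A zero ∙ p))
      where
      cancel : ∀ c w → c * w + (- w) * c ≡ 0ℤ
      cancel = solve-∀
    module P = Pivot B d row₀ (compatible-reduceBy A p e {d} compat)

module _ (q : ℕ) .{{_ : ℕ.NonZero q}} {m n} (C : Mat m n) (b : Fin n → ℤ) (J : Subset n) (j : Fin n) where

  open Modulo q
  open import Relation.Binary.Reasoning.Setoid ≈-setoid

  private
    inH : ∀ z {i} → InH q C b J z → i ∈ J → z ∙ col C i ≈ b i
    inH z z∈H i∈J = ≡[mod]⇒≈ (z∈H _ i∈J)

    bᴶ : Fin n → ℤ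
    bᴶ i = if lookup J i then b i else 0ℤ

  HSubset⇒compatible : HNonempty q C b J → HSubset q C b J j → Compatible (C ↾ J) (col C j)
  HSubset⇒compatible (z₀ , z₀∈H) H⊆ z z∈ker = begin
    z ∙ col C j
      ≡⟨ shift (z₀ ∙ col C j) (z ∙ col C j) ⟩
    (z₀ ∙ col C j + z ∙ col C j) + - (z₀ ∙ col C j)
      ≡⟨ cong (_+ - (z₀ ∙ col C j)) (sym (∙-distribʳ-+ z₀ z (col C j))) ⟩
    z₀+z ∙ col C j + - (z₀ ∙ col C j)
      ≈⟨ +-cong (inHⱼ z₀+z z₀+z∈H) (-‿cong (inHⱼ z₀ z₀∈H)) ⟩
    b j + - b j
      ≡⟨ +-inverseʳ (b j) ⟩
    0ℤ
      ∎
    where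
    shift : ∀ a c → c ≡ (a + c) + - a
    shift = solve-∀
    inHⱼ : ∀ z → InH q C b J z → z ∙ col C j ≈ b j
    inHⱼ z z∈H = ≡[mod]⇒≈ (H⊆ z z∈H j (x∈⁅x⁆ j))
    z₀+z : Fin m → ℤ
    z₀+z l = z₀ l + z l
    z∙cᵢ≈0 : ∀ {i} → i ∈ J → z ∙ col C i ≈ 0ℤ
    z∙cᵢ≈0 {i} i∈J = begin
      z ∙ col C i
        ≡⟨ cong (λ β → if β then z ∙ col C i else 0ℤ) ([]=⇒lookup i∈J) ⟨
      (if lookup J i then z ∙ col C i else 0ℤ)
        ≡⟨ ↾-col∙ C J z i ⟨
      z ∙ col (C ↾ J) i
        ≈⟨ z∈ker i ⟩
      0ℤ
        ∎
    z₀+z∈H : InH q C b J z₀+z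
    z₀+z∈H i i∈J = ≈⇒≡[mod] (begin
      z₀+z ∙ col C i                ≡⟨ ∙-distribʳ-+ z₀ z (col C i) ⟩
      z₀ ∙ col C i + z ∙ col C i    ≈⟨ +-cong (inH z₀ z₀∈H i∈J) (z∙cᵢ≈0 i∈J) ⟩
      b i + 0ℤ                      ≡⟨ +-identityʳ (b i) ⟩
      b i                           ∎)

  HSubset⇒condB : HNonempty q C b J → HSubset q C b J j → CondB q C J j
  HSubset⇒condB nonempty H⊆ = μ , λ l → ≈⇒≡[mod] (≈-trans (≈-reflexive (sym (↾-row∙ C J l μ))) (combination l))
    where
    solution = compatible⇒solvable (C ↾ J) (col C j) (HSubset⇒compatible nonempty H⊆)
    μ : Fin n → ℤ
    μ = proj₁ solution
    combination : ∀ l → (C ↾ J) l ∙ μ ≈ C l j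
    combination = proj₂ solution

  ∙cⱼ-constant-on-H : (μ : Fin n → ℤ) → (∀ l → (C ↾ J) l ∙ μ ≈ C l j) →
                      ∀ z → InH q C b J z → z ∙ col C j ≈ bᴶ ∙ μ
  ∙cⱼ-constant-on-H μ combination z z∈H = begin
    z ∙ col C j                      ≈⟨ ≈-∙-congʳ z (λ l → ≈-sym (combination l)) ⟩
    z ∙ (λ l → (C ↾ J) l ∙ μ)        ≡⟨ ∙-assoc z (C ↾ J) μ ⟩
    (λ i → z ∙ col (C ↾ J) i) ∙ μ    ≈⟨ ≈-∙-congˡ μ on-J ⟩
    bᴶ ∙ μ                           ∎
    where
    if-cong : ∀ β {x y} → (β ≡ true → x ≈ y) → (if β then x else 0ℤ) ≈ (if β then y else 0ℤ)
    if-cong true  x≈y = x≈y refl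
    if-cong false _   = ≈-refl
    on-J : ∀ i → z ∙ col (C ↾ J) i ≈ bᴶ i
    on-J i = ≈-trans (≈-reflexive (↾-col∙ C J z i))
                     (if-cong (lookup J i) (λ eq → inH z z∈H (lookup⇒[]= i J eq)))

  condA∧condB⇒HSubset : CondA q C b J j × CondB q C J j → HSubset q C b J j
  condA∧condB⇒HSubset ((λ₀ , λ₀∙cⱼ≡bⱼ , λ₀∈H) , μ , μ-combination) z z∈H i i∈⁅j⁆
    rewrite x∈⁅y⁆⇒x≡y j i∈⁅j⁆ = ≈⇒≡[mod] (begin
      z ∙ col C j    ≈⟨ ∙cⱼ-constant-on-H μ combination z z∈H ⟩
      bᴶ ∙ μ         ≈⟨ ≈-sym (∙cⱼ-constant-on-H μ combination λ₀ λ₀∈H) ⟩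
      λ₀ ∙ col C j   ≈⟨ ≡[mod]⇒≈ λ₀∙cⱼ≡bⱼ ⟩
      b j            ∎)
    where
    combination : ∀ l → (C ↾ J) l ∙ μ ≈ C l j
    combination l = ≈-trans (≈-reflexive (↾-row∙ C J l μ)) (≡[mod]⇒≈ (μ-combination l))

lemma4p3 : (m n q : ℕ) → 1 ≤ m → 1 ≤ n → 1 ≤ q →
    (C : Mat m n) (b : Fin n → ℤ) (j : Fin n) (J : Subset n) →
    HNonempty q C b J →
    HSubset q C b J j ⇔ (CondA q C b J j × CondB q C J j)
lemma4p3 m n q _ _ 1≤q C b j J nonempty@(z₀ , z₀∈H) = mk⇔
  (λ H⊆ → (z₀ , H⊆ z₀ z₀∈H j (x∈⁅x⁆ j) , z₀∈H) , HSubset⇒condB q C b J j nonempty H⊆)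
  (condA∧condB⇒HSubset q C b J j)
  where
  instance
    q≢0 : ℕ.NonZero q
    q≢0 = ℕ.>-nonZero 1≤q
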